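{- Let $G$ be a pendant graph of size $m$ and order $n$. Then $\overline{G}$ is $N$-AW if and only if $\gcd(2[n-m]-1,\ell)=1$. Equivalently, if $G$ is a graph of even order $n$ and size $\binom{n}{2} - \left(\frac{n}{2} +k\right)$ such that $\overline{G}$ is a pendant graph, then $G$ is $N$-AW if and only if $\gcd(n-2k-1,\ell)=1$.
   Context: Neighborhood Lights Out game: vertices labeled from $\mathbb{Z}_\ell$; toggling a vertex $v$ adds 1 (mod $\ell$) to each label in the closed neighborhood $N[v]$; won when all labels are 0. A graph is $N$-AW if the game is winnable from every initial labeling. A pendant graph is a graph of the form $H\odot K_1$: obtained from a graph $H$ by adding, for each vertex $v$ of $H$, a new vertex adjacent only to $v$. $\overline{G}$ is the complement of $G$. -}

module Defs where

open import Data.Nat using (ℕ; zero; suc; _+_; _<ᵇ_; NonZero)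
open import Data.Nat.DivMod using (_%_; m%n<n)
open import Data.Fin using (Fin; toℕ; fromℕ<; splitAt)
open import Data.Fin.Properties using (_≟_)
open import Data.Bool using (Bool; true; false; not; _∧_; _∨_; if_then_else_)
open import Data.List using (List; []; _∷_; map; allFin)
open import Data.Nat.ListAction using (sum)
open import Data.Sum using (inj₁; inj₂)
open import Data.Product using (∃; Σ)
open import Function.Bundles using (_↔_; Inverse)
open import Relation.Nullary.Decidable using (⌊_⌋)
open import Relation.Binary.PropositionalEquality using (_≡_; refl)

record Graph (n : ℕ) : Set where
  field
    adj    : Fin n → Fin n → Bool
    sym    : ∀ i j → adj i j ≡ adj j i
    irrefl : ∀ i → adj i i ≡ false
open Graph public

-- order of a graph on Fin n is n; size = number of edges (unordered pairs i<j adjacent)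
size : ∀ {n} → Graph n → ℕ
size {n} G = sum (map (λ i → sum (map (λ j →
  if (toℕ i <ᵇ toℕ j) ∧ adj G i j then 1 else 0) (allFin n))) (allFin n))

complement : ∀ {n} → Graph n → Graph n
complement G = record
  { adj    = λ i j → not ⌊ i ≟ j ⌋ ∧ not (adj G i j)
  ; sym    = λ i j → lem i j
  ; irrefl = λ i → irr i
  }
  where
  open import Relation.Binary.PropositionalEquality using (cong; cong₂; sym)
  open import Relation.Nullary using (yes; no)
  open import Relation.Nullary.Negation using (contradiction)
  lem : ∀ i j → not ⌊ i ≟ j ⌋ ∧ not (adj G i j) ≡ not ⌊ j ≟ i ⌋ ∧ not (adj G j i)
  lem i j with i ≟ j | j ≟ i
  ... | yes _ | yes _ = refl
  ... | no _  | no _  = cong not (Graph.sym G i j)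
  ... | yes p | no q  = contradiction (Relation.Binary.PropositionalEquality.sym p) q
  ... | no p  | yes q = contradiction (Relation.Binary.PropositionalEquality.sym q) p
  irr : ∀ i → not ⌊ i ≟ i ⌋ ∧ not (adj G i i) ≡ false
  irr i with i ≟ i
  ... | yes _ = refl
  ... | no p  = contradiction refl p

-- Corona H ⊙ K₁ on Fin (h + h): vertices (inj₁ i) are those of H,
-- vertex (inj₂ i) is the new pendant vertex attached to (inj₁ i).
coronaAdj : ∀ {h} → Graph h → Fin (h + h) → Fin (h + h) → Bool
coronaAdj {h} H x y with splitAt h x | splitAt h y
... | inj₁ i | inj₁ j = adj H i j
... | inj₁ i | inj₂ j = ⌊ i ≟ j ⌋
... | inj₂ i | inj₁ j = ⌊ i ≟ j ⌋
... | inj₂ i | inj₂ j = false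

Isomorphic : ∀ {n m} → Graph n → Graph m → Set
Isomorphic {n} {m} G G' = Σ (Fin n ↔ Fin m) λ σ →
  ∀ i j → adj G' (Inverse.to σ i) (Inverse.to σ j) ≡ adj G i j

IsPendant : ∀ {n} → Graph n → Set
IsPendant {n} G = ∃ λ h → Σ (Graph h) λ H →
  Σ (∀ x y → coronaAdj H x y ≡ coronaAdj H y x) λ s →
  Σ (∀ x → coronaAdj H x x ≡ false) λ r →
  Isomorphic G (record { adj = coronaAdj H ; sym = s ; irrefl = r })

Labeling : ℕ → ℕ → Set
Labeling n ℓ = Fin n → Fin ℓ

inc : ∀ {ℓ} .{{_ : NonZero ℓ}} → Fin ℓ → Fin ℓ
inc {ℓ} a = fromℕ< (m%n<n (suc (toℕ a)) ℓ)

inClosedNbhd : ∀ {n} → Graph n → Fin n → Fin n → Bool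
inClosedNbhd G v u = ⌊ u ≟ v ⌋ ∨ adj G v u

toggle : ∀ {n ℓ} .{{_ : NonZero ℓ}} → Graph n → Fin n → Labeling n ℓ → Labeling n ℓ
toggle G v b u = if inClosedNbhd G v u then inc (b u) else b u

play : ∀ {n ℓ} .{{_ : NonZero ℓ}} → Graph n → List (Fin n) → Labeling n ℓ → Labeling n ℓ
play G []       b = b
play G (v ∷ vs) b = play G vs (toggle G v b)

Won : ∀ {n ℓ} → Labeling n ℓ → Set
Won b = ∀ u → toℕ (b u) ≡ 0

Winnable : ∀ {n ℓ} .{{_ : NonZero ℓ}} → Graph n → Labeling n ℓ → Set
Winnable G b = ∃ λ (moves : List _) → Won (play G moves b)

IsNAW : ∀ {n} (ℓ : ℕ) .{{_ : NonZero ℓ}} → Graph n → Set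
IsNAW {n} ℓ G = ∀ (b : Labeling n ℓ) → Winnable G b

-- Let A be the adjacency matrix of the corona H ⊙ K₁ and J the all-ones matrix. The closed
-- neighbourhoods of its complement form the matrix J - A, so a labeling b can be cleared
-- exactly when (J - A) x ≡ -b (mod ℓ) has a solution x of press counts. The matrix A is
-- invertible over ℤ; put y = A⁻¹ 1 and d = Σ y - 1, which equals 2 (n - m) - 1 by the
-- handshake lemma. If a d ≡ 1 (mod ℓ), then x = a (y · t) y - A⁻¹ t solves (J - A) x ≡ t.
-- Conversely (J - A) y = d 1, so for g = gcd (d, ℓ) the weight Σ y_u b_u is invariant modulo
-- g; clearing the labeling with a single 1 at u forces g ∣ y u for every u, hence
-- g ∣ Σ y = d + 1, and g = 1. The second statement is the first one for the complement of G,
-- since complementation is involutive and size G + size (complement G) = n choose 2.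

module Submission where

open import Defs hiding (sym)

open import Data.Bool using (Bool; true; false; if_then_else_; not; _∧_; _∨_)
open import Data.Empty using (⊥-elim)
open import Data.Fin using (Fin; zero; suc; toℕ; fromℕ<; splitAt; _↑ˡ_; _↑ʳ_)
open import Data.Fin.Permutation using (↔⇒≡)
open import Data.Fin.Properties
  using ( _≟_; toℕ<n; toℕ-fromℕ<; toℕ-injective
        ; splitAt-↑ˡ; splitAt-↑ʳ; splitAt⁻¹-↑ˡ; splitAt⁻¹-↑ʳ)
open import Data.Integer as ℤ using (ℤ; +_; -_; _+_; _-_; _*_; 0ℤ; 1ℤ; -1ℤ)
open import Data.Integer.DivMod using (_%ℕ_; _/ℕ_; a≡a%ℕn+[a/ℕn]*n)
open import Data.Integer.Divisibility.Signed
  using (_∣_; divides; ∣-trans; ∣m∣n⇒∣m+n; ∣n⇒∣m*n; ∣m⇒∣-m; ∣⇒∣ᵤ; ∣ᵤ⇒∣)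
open import Data.Integer.GCD using (gcd; gcd[i,j]∣i; gcd[i,j]∣j)
import Data.Integer.Properties as ℤP
open import Data.Integer.Properties using (+∣i∣≡i⊎+∣i∣≡-i)
open import Algebra.Properties.Semiring.Sum ℤP.+-*-semiring
  using ( sum; sum-syntax; ∑-comm; ∑-permute; ∑-distrib-+; *-distribˡ-sum; *-distribʳ-sum
        ; sum-cong-≗; sum-replicate-zero)
open import Data.Integer.Tactic.RingSolver using (solve-∀)
open import Data.List using (List; []; _∷_; _++_; replicate; map; allFin; tabulate)
open import Data.List.Properties using (map-tabulate)
import Data.Nat
open import Data.Nat as ℕ using (ℕ; zero; suc; NonZero; _≤_; _<_; _<ᵇ_; _/_; _%_)
open import Data.Nat.Combinatorics using (_C_; nCk+nC[k+1]≡[n+1]C[k+1]; nC1≡n)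
open import Data.Nat.Coprimality using (gcd≡1⇒coprime; coprime-Bézout)
open import Data.Nat.Divisibility using (∣⇒≤; ∣1⇒≡1) renaming (_∣_ to _ℕ∣_)
open import Data.Nat.DivMod using (m≡m%n+[m/n]*n)
open import Data.Nat.GCD using (module Bézout)
import Data.Nat.ListAction as ListSum
import Data.Nat.Properties as ℕP
open import Data.Nat.Properties using (<ᵇ-reflects-<)
open import Data.Product using (∃-syntax; _×_; _,_; proj₁; proj₂)
open import Data.Sum using (inj₁; inj₂)
import Data.Vec.Functional as V
open import Data.Vec.Functional.Properties using (lookup-++ˡ; lookup-++ʳ)
open import Function.Bundles using (Inverse; _⇔_; mk⇔)
open import Function.Properties.Equivalence using () renaming (trans to ⇔-trans)
open import Function.Properties.Inverse using (↔-refl; ↔-sym)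
open import Level using (0ℓ)
open import Relation.Binary.Bundles using (Setoid)
open import Relation.Binary.PropositionalEquality
  using (_≡_; refl; sym; trans; cong; cong₂; subst; module ≡-Reasoning)
import Relation.Binary.Reasoning.Setoid
open import Relation.Nullary using (yes; no; ofʸ; ofⁿ)
open import Relation.Nullary.Decidable using (⌊_⌋)

χ : Bool → ℤ
χ true  = 1ℤ
χ false = 0ℤ

-- Finite sums

sum-zero : ∀ {n} {f : Fin n → ℤ} → (∀ i → f i ≡ 0ℤ) → sum f ≡ 0ℤ
sum-zero {n} f≡0 = trans (sum-cong-≗ f≡0) (sum-replicate-zero n)

sum-one : ∀ n → ∑[ i < n ] 1ℤ ≡ + n
sum-one zero    = refl
sum-one (suc n) = cong (λ s → 1ℤ + s) (sum-one n)

sum-const : ∀ n c → ∑[ i < n ] c ≡ + n * c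
sum-const zero    c = sym (ℤP.*-zeroˡ c)
sum-const (suc n) c = trans (cong (λ s → c + s) (sum-const n c)) (sym (ℤP.suc-* (+ n) c))

∑-neg : ∀ {n} (f : Fin n → ℤ) → ∑[ i < n ] (- f i) ≡ - sum f
∑-neg f = begin
  sum (λ i → - f i)       ≡⟨ sum-cong-≗ (λ i → sym (ℤP.-1*i≡-i (f i))) ⟩
  sum (λ i → -1ℤ * f i)   ≡⟨ *-distribˡ-sum -1ℤ f ⟨
  -1ℤ * sum f             ≡⟨ ℤP.-1*i≡-i (sum f) ⟩
  - sum f                 ∎
  where open ≡-Reasoning

∑-distrib-- : ∀ {n} (f g : Fin n → ℤ) → ∑[ i < n ] (f i - g i) ≡ sum f - sum g
∑-distrib-- f g = trans (∑-distrib-+ f (λ i → - g i)) (cong (λ s → sum f + s) (∑-neg g))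

∑-↑ˡ-↑ʳ : ∀ m n (f : Fin (m ℕ.+ n) → ℤ) → sum f ≡ ∑[ i < m ] f (i ↑ˡ n) + ∑[ j < n ] f (m ↑ʳ j)
∑-↑ˡ-↑ʳ zero    n f = sym (ℤP.+-identityˡ (sum f))
∑-↑ˡ-↑ʳ (suc m) n f =
  trans (cong (λ s → f zero + s) (∑-↑ˡ-↑ʳ m n (λ i → f (suc i)))) (sym (ℤP.+-assoc (f zero) _ _))

∑-select : ∀ {n} (i : Fin n) (f : Fin n → ℤ) → ∑[ j < n ] (χ ⌊ j ≟ i ⌋ * f j) ≡ f i
∑-select {suc n} zero f = begin
  1ℤ * f zero + ∑[ j < n ] (χ ⌊ suc j ≟ zero ⌋ * f (suc j))
    ≡⟨ cong₂ _+_ (ℤP.*-identityˡ (f zero)) (sum-zero (λ j → ℤP.*-zeroˡ (f (suc j)))) ⟩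
  f zero + 0ℤ
    ≡⟨ ℤP.+-identityʳ (f zero) ⟩
  f zero ∎
  where open ≡-Reasoning
∑-select {suc n} (suc i) f = begin
  0ℤ * f zero + ∑[ j < n ] (χ ⌊ suc j ≟ suc i ⌋ * f (suc j))
    ≡⟨ ℤP.+-identityˡ _ ⟩
  ∑[ j < n ] (χ ⌊ suc j ≟ suc i ⌋ * f (suc j))
    ≡⟨ sum-cong-≗ (λ j → cong (λ b → χ b * f (suc j)) (≟-suc j i)) ⟩
  ∑[ j < n ] (χ ⌊ j ≟ i ⌋ * f (suc j))
    ≡⟨ ∑-select i (λ j → f (suc j)) ⟩
  f (suc i) ∎
  where
  open ≡-Reasoning
  ≟-suc : ∀ {m} (j i : Fin m) → ⌊ suc j ≟ suc i ⌋ ≡ ⌊ j ≟ i ⌋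
  ≟-suc j i with j ≟ i
  ... | yes refl = refl
  ... | no _     = refl

∑-scale-sub : ∀ {n} c (f g : Fin n → ℤ) → ∑[ i < n ] (c * f i - g i) ≡ c * sum f - sum g
∑-scale-sub c f g = trans (∑-distrib-- (λ i → c * f i) g) (cong (_- sum g) (sym (*-distribˡ-sum c f)))

↑ˡ-↑ʳ-elim : ∀ {m n} (P : Fin (m ℕ.+ n) → Set) →
  (∀ i → P (i ↑ˡ n)) → (∀ j → P (m ↑ʳ j)) → ∀ k → P k
↑ˡ-↑ʳ-elim {m} P on-↑ˡ on-↑ʳ k with splitAt m k in eq
... | inj₁ i = subst P (splitAt⁻¹-↑ˡ eq) (on-↑ˡ i)
... | inj₂ j = subst P (splitAt⁻¹-↑ʳ eq) (on-↑ʳ j)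

-- Congruences of integers

-- A record rather than q ∣ a - b, so that a and b can be recovered by unification.
infix 4 _≡_mod_
record _≡_mod_ (a b q : ℤ) : Set where
  constructor congruent
  field divides-difference : q ∣ a - b
open _≡_mod_

module _ {q : ℤ} where

  ≡-mod-reflexive : ∀ {a b} → a ≡ b → a ≡ b mod q
  ≡-mod-reflexive {a} refl = congruent (divides 0ℤ (trans (ℤP.+-inverseʳ a) (sym (ℤP.*-zeroˡ q))))

  ≡-mod-refl : ∀ {a} → a ≡ a mod q
  ≡-mod-refl = ≡-mod-reflexive refl

  ≡-mod-sym : ∀ {a b} → a ≡ b mod q → b ≡ a mod q
  ≡-mod-sym {a} {b} (congruent q∣a-b) = congruent (subst (q ∣_) (negate a b) (∣m⇒∣-m q∣a-b))
    where
    negate : ∀ a b → - (a - b) ≡ b - a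
    negate = solve-∀

  ≡-mod-trans : ∀ {a b c} → a ≡ b mod q → b ≡ c mod q → a ≡ c mod q
  ≡-mod-trans {a} {b} {c} (congruent q∣a-b) (congruent q∣b-c) =
    congruent (subst (q ∣_) (telescope a b c) (∣m∣n⇒∣m+n q∣a-b q∣b-c))
    where
    telescope : ∀ a b c → (a - b) + (b - c) ≡ a - c
    telescope = solve-∀

  ≡-mod-setoid : Setoid 0ℓ 0ℓ
  ≡-mod-setoid = record
    { Carrier       = ℤ
    ; _≈_           = λ a b → a ≡ b mod q
    ; isEquivalence = record { refl = ≡-mod-refl ; sym = ≡-mod-sym ; trans = ≡-mod-trans }
    }

  ≡-mod-+ : ∀ {a b c d} → a ≡ b mod q → c ≡ d mod q → a + c ≡ b + d mod q
  ≡-mod-+ {a} {b} {c} {d} (congruent q∣a-b) (congruent q∣c-d) =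
    congruent (subst (q ∣_) (interchange a b c d) (∣m∣n⇒∣m+n q∣a-b q∣c-d))
    where
    interchange : ∀ a b c d → (a - b) + (c - d) ≡ (a + c) - (b + d)
    interchange = solve-∀

  ≡-mod-+ˡ : ∀ a {b c} → b ≡ c mod q → a + b ≡ a + c mod q
  ≡-mod-+ˡ a = ≡-mod-+ (≡-mod-refl {a})

  ≡-mod-neg : ∀ {a b} → a ≡ b mod q → - a ≡ - b mod q
  ≡-mod-neg {a} {b} (congruent q∣a-b) = congruent (subst (q ∣_) (negate a b) (∣m⇒∣-m q∣a-b))
    where
    negate : ∀ a b → - (a - b) ≡ - a - - b
    negate = solve-∀

  ≡-mod-*ˡ : ∀ c {a b} → a ≡ b mod q → c * a ≡ c * b mod q
  ≡-mod-*ˡ c {a} {b} (congruent q∣a-b) = congruent (subst (q ∣_) (distrib c a b) (∣n⇒∣m*n c q∣a-b))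
    where
    distrib : ∀ c a b → c * (a - b) ≡ c * a - c * b
    distrib = solve-∀

  ≡-mod-sum : ∀ {n} {f g : Fin n → ℤ} → (∀ i → f i ≡ g i mod q) → sum f ≡ sum g mod q
  ≡-mod-sum {zero}  fg = ≡-mod-refl
  ≡-mod-sum {suc n} fg = ≡-mod-+ (fg zero) (≡-mod-sum (λ i → fg (suc i)))

  ∑≡0-mod : ∀ {n} {f : Fin n → ℤ} → (∀ i → f i ≡ 0ℤ mod q) → sum f ≡ 0ℤ mod q
  ∑≡0-mod {n} f≡0 = ≡-mod-trans (≡-mod-sum f≡0) (≡-mod-reflexive (sum-replicate-zero n))

  module ≡-mod-Reasoning = Relation.Binary.Reasoning.Setoid ≡-mod-setoid

∣⇒≡0-mod : ∀ {q a} → q ∣ a → a ≡ 0ℤ mod q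
∣⇒≡0-mod {q} {a} q∣a = congruent (subst (q ∣_) (sym (ℤP.+-identityʳ a)) q∣a)

≡-mod-weaken : ∀ {p q a b} → p ∣ q → a ≡ b mod q → a ≡ b mod p
≡-mod-weaken p∣q (congruent q∣a-b) = congruent (∣-trans p∣q q∣a-b)

%ℕ-≡-mod : ∀ x ℓ .{{_ : NonZero ℓ}} → + (x %ℕ ℓ) ≡ x mod + ℓ
%ℕ-≡-mod x ℓ = congruent (divides (- (x /ℕ ℓ)) (begin
  + (x %ℕ ℓ) - x                               ≡⟨ cong (λ z → + (x %ℕ ℓ) - z) (a≡a%ℕn+[a/ℕn]*n x ℓ) ⟩
  + (x %ℕ ℓ) - (+ (x %ℕ ℓ) + x /ℕ ℓ * + ℓ)   ≡⟨ cancel (+ (x %ℕ ℓ)) (x /ℕ ℓ) (+ ℓ) ⟩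
  - (x /ℕ ℓ) * + ℓ                             ∎))
  where
  open ≡-Reasoning
  cancel : ∀ r k l → r - (r + k * l) ≡ - k * l
  cancel = solve-∀

pos-1+*≡* : ∀ a b c e → suc (a ℕ.* b) ≡ c ℕ.* e → 1ℤ + + a * + b ≡ + c * + e
pos-1+*≡* a b c e eq = trans (cong (λ p → 1ℤ + p) (sym (ℤP.pos-* a b))) (trans (cong +_ eq) (ℤP.pos-* c e))

Bézout⇒invertible : ∀ {m ℓ} → Bézout.Identity 1 m ℓ → ∃[ a ] a * + m ≡ 1ℤ mod + ℓ
Bézout⇒invertible {m} {ℓ} (Bézout.+- x y eq) = + x , congruent (divides (+ y) (begin
  + x * + m - 1ℤ        ≡⟨ cong (_- 1ℤ) (pos-1+*≡* y ℓ x m eq) ⟨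
  1ℤ + + y * + ℓ - 1ℤ   ≡⟨ cancel (+ y * + ℓ) ⟩
  + y * + ℓ             ∎))
  where
  open ≡-Reasoning
  cancel : ∀ p → 1ℤ + p - 1ℤ ≡ p
  cancel = solve-∀
Bézout⇒invertible {m} {ℓ} (Bézout.-+ x y eq) = - + x , congruent (divides (- + y) (begin
  - + x * + m - 1ℤ      ≡⟨ negate (+ x) (+ m) ⟩
  - (1ℤ + + x * + m)    ≡⟨ cong -_ (pos-1+*≡* x m y ℓ eq) ⟩
  - (+ y * + ℓ)         ≡⟨ ℤP.neg-distribˡ-* (+ y) (+ ℓ) ⟩
  - + y * + ℓ           ∎))
  where
  open ≡-Reasoning
  negate : ∀ a b → - a * b - 1ℤ ≡ - (1ℤ + a * b)
  negate = solve-∀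

gcd≡1⇒invertible : ∀ d ℓ → gcd d (+ ℓ) ≡ + 1 → ∃[ a ] a * d ≡ 1ℤ mod + ℓ
gcd≡1⇒invertible d ℓ gcd≡1
  with a , a∣d∣≡1 ← Bézout⇒invertible (coprime-Bézout (gcd≡1⇒coprime (ℤP.+-injective gcd≡1)))
  with +∣i∣≡i⊎+∣i∣≡-i d
... | inj₁ ∣d∣≡d  = a , subst (λ e → a * e ≡ 1ℤ mod + ℓ) ∣d∣≡d a∣d∣≡1
... | inj₂ ∣d∣≡-d =
  - a , subst (λ e → e ≡ 1ℤ mod + ℓ) (trans (cong (a *_) ∣d∣≡-d) (swap-neg a d)) a∣d∣≡1
  where
  swap-neg : ∀ a d → a * - d ≡ - a * d
  swap-neg = solve-∀

-- Neighbourhood sums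

closedNbhdSum : ∀ {n} → Graph n → (Fin n → ℤ) → Fin n → ℤ
closedNbhdSum {n} G x u = ∑[ v < n ] (χ (inClosedNbhd G v u) * x v)

inClosedNbhd-sym : ∀ {n} (G : Graph n) v u → inClosedNbhd G v u ≡ inClosedNbhd G u v
inClosedNbhd-sym G v u with u ≟ v | v ≟ u
... | yes _    | yes _    = refl
... | no _     | no _     = Graph.sym G v u
... | yes refl | no v≢v   = ⊥-elim (v≢v refl)
... | no u≢u   | yes refl = ⊥-elim (u≢u refl)

closedNbhdSum-cong : ∀ {n q} (G : Graph n) {x y : Fin n → ℤ} →
  (∀ v → x v ≡ y v mod q) → ∀ u → closedNbhdSum G x u ≡ closedNbhdSum G y u mod q
closedNbhdSum-cong G x≡y u = ≡-mod-sum (λ v → ≡-mod-*ˡ (χ (inClosedNbhd G v u)) (x≡y v))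

openNbhdSum : ∀ {n} → Graph n → (Fin n → ℤ) → Fin n → ℤ
openNbhdSum {n} G x u = ∑[ v < n ] (χ (adj G v u) * x v)

χ-inClosedNbhd-complement : ∀ {n} (G : Graph n) v u →
  χ (inClosedNbhd (complement G) v u) ≡ 1ℤ - χ (adj G v u)
χ-inClosedNbhd-complement G v u with u ≟ v | v ≟ u
... | yes refl | _        rewrite Graph.irrefl G u = refl
... | no u≢v   | yes refl = ⊥-elim (u≢v refl)
... | no _     | no _     with adj G v u
...   | true  = refl
...   | false = refl

closedNbhdSum-complement : ∀ {n} (G : Graph n) x u →
  closedNbhdSum (complement G) x u ≡ sum x - openNbhdSum G x u
closedNbhdSum-complement G x u = begin
  closedNbhdSum (complement G) x u
    ≡⟨ sum-cong-≗ (λ v → cong (_* x v) (χ-inClosedNbhd-complement G v u)) ⟩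
  ∑[ v < _ ] ((1ℤ - χ (adj G v u)) * x v)
    ≡⟨ sum-cong-≗ (λ v → distrib (χ (adj G v u)) (x v)) ⟩
  ∑[ v < _ ] (x v - χ (adj G v u) * x v)
    ≡⟨ ∑-distrib-- x (λ v → χ (adj G v u) * x v) ⟩
  sum x - openNbhdSum G x u ∎
  where
  open ≡-Reasoning
  distrib : ∀ a b → (1ℤ - a) * b ≡ b - a * b
  distrib = solve-∀

openNbhdSum-adjoint : ∀ {n} (G : Graph n) x z →
  ∑[ u < n ] (x u * openNbhdSum G z u) ≡ ∑[ v < n ] (openNbhdSum G x v * z v)
openNbhdSum-adjoint {n} G x z = begin
  ∑[ u < n ] (x u * ∑[ v < n ] (χ (adj G v u) * z v))
    ≡⟨ sum-cong-≗ (λ u → *-distribˡ-sum (x u) (λ v → χ (adj G v u) * z v)) ⟩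
  ∑[ u < n ] ∑[ v < n ] (x u * (χ (adj G v u) * z v))
    ≡⟨ ∑-comm (λ u v → x u * (χ (adj G v u) * z v)) ⟩
  ∑[ v < n ] ∑[ u < n ] (x u * (χ (adj G v u) * z v))
    ≡⟨ sum-cong-≗ (λ v → sum-cong-≗ (λ u → regroup u v)) ⟩
  ∑[ v < n ] ∑[ u < n ] (χ (adj G u v) * x u * z v)
    ≡⟨ sum-cong-≗ (λ v → *-distribʳ-sum (z v) (λ u → χ (adj G u v) * x u)) ⟨
  ∑[ v < n ] (openNbhdSum G x v * z v) ∎
  where
  open ≡-Reasoning
  regroup : ∀ u v → x u * (χ (adj G v u) * z v) ≡ χ (adj G u v) * x u * z v
  regroup u v = trans (cong (λ b → x u * (χ b * z v)) (Graph.sym G v u)) (rearrange (x u) (χ (adj G u v)) (z v))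
    where
    rearrange : ∀ a b c → a * (b * c) ≡ b * a * c
    rearrange = solve-∀

openNbhdSum-scale-sub : ∀ {n} (G : Graph n) c x z u →
  openNbhdSum G (λ v → c * x v - z v) u ≡ c * openNbhdSum G x u - openNbhdSum G z u
openNbhdSum-scale-sub G c x z u =
  trans (sum-cong-≗ (λ v → distrib (χ (adj G v u)) c (x v) (z v)))
        (∑-scale-sub c (λ v → χ (adj G v u) * x v) (λ v → χ (adj G v u) * z v))
  where
  distrib : ∀ e c a b → e * (c * a - b) ≡ c * (e * a) - e * b
  distrib = solve-∀

-- The game modulo ℓ

tally : ∀ {n} → Graph n → List (Fin n) → Fin n → ℤ
tally G []       u = 0ℤ
tally G (v ∷ vs) u = χ (inClosedNbhd G v u) + tally G vs u

module _ {n ℓ : ℕ} .{{_ : NonZero ℓ}} (G : Graph n) where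

  toggle-≡ : ∀ v (b : Labeling n ℓ) u →
    + toℕ (toggle G v b u) ≡ χ (inClosedNbhd G v u) + + toℕ (b u) mod + ℓ
  toggle-≡ v b u with inClosedNbhd G v u
  ... | true  = ≡-mod-trans (≡-mod-reflexive (cong +_ (toℕ-fromℕ< _))) (%ℕ-≡-mod (+ suc (toℕ (b u))) ℓ)
  ... | false = ≡-mod-reflexive (sym (ℤP.+-identityˡ _))

  play-≡ : ∀ ms (b : Labeling n ℓ) u → + toℕ (play G ms b u) ≡ + toℕ (b u) + tally G ms u mod + ℓ
  play-≡ []       b u = ≡-mod-reflexive (sym (ℤP.+-identityʳ _))
  play-≡ (v ∷ vs) b u =
    ≡-mod-trans (play-≡ vs (toggle G v b) u)
      (≡-mod-trans (≡-mod-+ (toggle-≡ v b u) ≡-mod-refl)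
        (≡-mod-reflexive (reassoc (χ (inClosedNbhd G v u)) (+ toℕ (b u)) (tally G vs u))))
    where
    reassoc : ∀ c a t → (c + a) + t ≡ a + (c + t)
    reassoc = solve-∀

pressing : ∀ {k n} → (Fin k → Fin n) → (Fin k → ℕ) → List (Fin n)
pressing {zero}  f x = []
pressing {suc k} f x = replicate (x zero) (f zero) ++ pressing (λ i → f (suc i)) (λ i → x (suc i))

module _ {n : ℕ} (G : Graph n) where

  tally-++ : ∀ ms ms′ u → tally G (ms ++ ms′) u ≡ tally G ms u + tally G ms′ u
  tally-++ []       ms′ u = sym (ℤP.+-identityˡ _)
  tally-++ (v ∷ ms) ms′ u =
    trans (cong (λ t → χ (inClosedNbhd G v u) + t) (tally-++ ms ms′ u))
          (sym (ℤP.+-assoc (χ (inClosedNbhd G v u)) (tally G ms u) (tally G ms′ u)))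

  tally-replicate : ∀ m v u → tally G (replicate m v) u ≡ χ (inClosedNbhd G v u) * + m
  tally-replicate zero    v u = sym (ℤP.*-zeroʳ (χ (inClosedNbhd G v u)))
  tally-replicate (suc m) v u =
    trans (cong (λ t → χ (inClosedNbhd G v u) + t) (tally-replicate m v u))
          (sym (ℤP.*-suc (χ (inClosedNbhd G v u)) (+ m)))

  tally-pressing : ∀ {k} (f : Fin k → Fin n) x u →
    tally G (pressing f x) u ≡ ∑[ i < k ] (χ (inClosedNbhd G (f i) u) * + x i)
  tally-pressing {zero}  f x u = refl
  tally-pressing {suc k} f x u = begin
    tally G (replicate (x zero) (f zero) ++ pressing (λ i → f (suc i)) (λ i → x (suc i))) u
      ≡⟨ tally-++ (replicate (x zero) (f zero)) _ u ⟩
    tally G (replicate (x zero) (f zero)) u + tally G (pressing (λ i → f (suc i)) (λ i → x (suc i))) u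
      ≡⟨ cong₂ _+_ (tally-replicate (x zero) (f zero) u) (tally-pressing (λ i → f (suc i)) (λ i → x (suc i)) u) ⟩
    χ (inClosedNbhd G (f zero) u) * + x zero + ∑[ i < k ] (χ (inClosedNbhd G (f (suc i)) u) * + x (suc i))
      ∎
    where open ≡-Reasoning

≡0-mod⇒≡0 : ∀ {m ℓ} → + m ≡ 0ℤ mod + ℓ → m < ℓ → m ≡ 0
≡0-mod⇒≡0 {zero}  _                   _   = refl
≡0-mod⇒≡0 {suc m} {ℓ} (congruent ℓ∣m+1) m<ℓ =
  ⊥-elim (ℕP.<⇒≱ m<ℓ (∣⇒≤ (subst (ℓ ℕ∣_) (ℕP.+-identityʳ (suc m)) (∣⇒∣ᵤ ℓ∣m+1))))

reachable⇒NAW : ∀ {n ℓ} .{{_ : NonZero ℓ}} (G : Graph n) →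
  (∀ t → ∃[ x ] ∀ u → closedNbhdSum G x u ≡ t u mod + ℓ) → IsNAW ℓ G
reachable⇒NAW {n} {ℓ} G reach b = moves , λ u → ≡0-mod⇒≡0 (cleared u) (toℕ<n _)
  where
  x : Fin n → ℤ
  x = proj₁ (reach (λ u → - + toℕ (b u)))
  moves : List (Fin n)
  moves = pressing (λ v → v) (λ v → x v %ℕ ℓ)
  cleared : ∀ u → + toℕ (play G moves b u) ≡ 0ℤ mod + ℓ
  cleared u = begin
    + toℕ (play G moves b u)
      ≈⟨ play-≡ G moves b u ⟩
    + toℕ (b u) + tally G moves u
      ≡⟨ cong (λ t → + toℕ (b u) + t) (tally-pressing G (λ v → v) (λ v → x v %ℕ ℓ) u) ⟩
    + toℕ (b u) + closedNbhdSum G (λ v → + (x v %ℕ ℓ)) u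
      ≈⟨ ≡-mod-+ˡ (+ toℕ (b u)) (closedNbhdSum-cong G (λ v → %ℕ-≡-mod (x v) ℓ) u) ⟩
    + toℕ (b u) + closedNbhdSum G x u
      ≈⟨ ≡-mod-+ˡ (+ toℕ (b u)) (proj₂ (reach _) u) ⟩
    + toℕ (b u) - + toℕ (b u)
      ≡⟨ ℤP.+-inverseʳ (+ toℕ (b u)) ⟩
    0ℤ ∎
    where open ≡-mod-Reasoning {q = + ℓ}

weight : ∀ {n ℓ} → (Fin n → ℤ) → Labeling n ℓ → ℤ
weight {n} w b = ∑[ u < n ] (w u * + toℕ (b u))

module _ {n ℓ : ℕ} .{{_ : NonZero ℓ}} (G : Graph n) {q : ℤ} (q∣ℓ : q ∣ + ℓ)
         (w : Fin n → ℤ) (w-balanced : ∀ v → closedNbhdSum G w v ≡ 0ℤ mod q) where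

  open ≡-mod-Reasoning {q = q}

  weighted-tally≡0 : ∀ ms → ∑[ u < n ] (w u * tally G ms u) ≡ 0ℤ mod q
  weighted-tally≡0 []       = ≡-mod-reflexive (sum-zero (λ u → ℤP.*-zeroʳ (w u)))
  weighted-tally≡0 (v ∷ vs) = begin
    ∑[ u < n ] (w u * (χ (inClosedNbhd G v u) + tally G vs u))
      ≡⟨ sum-cong-≗ (λ u → ℤP.*-distribˡ-+ (w u) (χ (inClosedNbhd G v u)) (tally G vs u)) ⟩
    ∑[ u < n ] (w u * χ (inClosedNbhd G v u) + w u * tally G vs u)
      ≡⟨ ∑-distrib-+ (λ u → w u * χ (inClosedNbhd G v u)) (λ u → w u * tally G vs u) ⟩
    ∑[ u < n ] (w u * χ (inClosedNbhd G v u)) + ∑[ u < n ] (w u * tally G vs u)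
      ≡⟨ cong (_+ ∑[ u < n ] (w u * tally G vs u)) (sum-cong-≗ transpose) ⟩
    closedNbhdSum G w v + ∑[ u < n ] (w u * tally G vs u)
      ≈⟨ ≡-mod-+ (w-balanced v) (weighted-tally≡0 vs) ⟩
    0ℤ + 0ℤ
      ≡⟨⟩
    0ℤ ∎
    where
    transpose : ∀ u → w u * χ (inClosedNbhd G v u) ≡ χ (inClosedNbhd G u v) * w u
    transpose u = trans (ℤP.*-comm (w u) _) (cong (λ b → χ b * w u) (inClosedNbhd-sym G v u))

  weight-play : ∀ ms (b : Labeling n ℓ) → weight w (play G ms b) ≡ weight w b mod q
  weight-play ms b = begin
    weight w (play G ms b)
      ≈⟨ ≡-mod-sum (λ u → ≡-mod-*ˡ (w u) (≡-mod-weaken q∣ℓ (play-≡ G ms b u))) ⟩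
    ∑[ u < n ] (w u * (+ toℕ (b u) + tally G ms u))
      ≡⟨ sum-cong-≗ (λ u → ℤP.*-distribˡ-+ (w u) (+ toℕ (b u)) (tally G ms u)) ⟩
    ∑[ u < n ] (w u * + toℕ (b u) + w u * tally G ms u)
      ≡⟨ ∑-distrib-+ (λ u → w u * + toℕ (b u)) (λ u → w u * tally G ms u) ⟩
    weight w b + ∑[ u < n ] (w u * tally G ms u)
      ≈⟨ ≡-mod-+ˡ (weight w b) (weighted-tally≡0 ms) ⟩
    weight w b + 0ℤ
      ≡⟨ ℤP.+-identityʳ (weight w b) ⟩
    weight w b ∎

  NAW⇒balanced-weight-divisible : 2 ≤ ℓ → IsNAW ℓ G → ∀ u → q ∣ w u
  NAW⇒balanced-weight-divisible 2≤ℓ naw u =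
    subst (q ∣_) (ℤP.+-identityʳ (w u)) (divides-difference (begin
      w u                           ≡⟨ weight-unit ⟨
      weight w unit                 ≈⟨ weight-play moves unit ⟨
      weight w (play G moves unit)  ≡⟨ sum-zero (λ v → trans (cong (λ k → w v * + k) (won v)) (ℤP.*-zeroʳ (w v))) ⟩
      0ℤ                            ∎))
    where
    unit : Labeling n ℓ
    unit v = if ⌊ v ≟ u ⌋ then fromℕ< 2≤ℓ else fromℕ< (ℕP.<-trans ℕP.0<1+n 2≤ℓ)
    moves : List (Fin n)
    moves = proj₁ (naw unit)
    won : Won (play G moves unit)
    won = proj₂ (naw unit)
    unit-value : ∀ v → + toℕ (unit v) ≡ χ ⌊ v ≟ u ⌋
    unit-value v with v ≟ u
    ... | yes _ = cong +_ (toℕ-fromℕ< 2≤ℓ)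
    ... | no _  = cong +_ (toℕ-fromℕ< _)
    weight-unit : weight w unit ≡ w u
    weight-unit = trans (sum-cong-≗ (λ v → trans (cong (w v *_) (unit-value v)) (ℤP.*-comm (w v) _)))
                        (∑-select u w)

-- Counting edges

+-sum-tabulate : ∀ {n} (f : Fin n → ℕ) → + ListSum.sum (tabulate f) ≡ ∑[ i < n ] (+ f i)
+-sum-tabulate {zero}  f = refl
+-sum-tabulate {suc n} f =
  trans (ℤP.pos-+ (f zero) _) (cong (λ s → + f zero + s) (+-sum-tabulate (λ i → f (suc i))))

+-sum-allFin : ∀ {n} (f : Fin n → ℕ) → + ListSum.sum (map f (allFin n)) ≡ ∑[ i < n ] (+ f i)
+-sum-allFin {n} f = trans (cong (λ xs → + ListSum.sum xs) (map-tabulate (λ i → i) f)) (+-sum-tabulate f)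

+-if : ∀ b → + (if b then 1 else 0) ≡ χ b
+-if true  = refl
+-if false = refl

orderedEdge : ∀ {n} → Graph n → Fin n → Fin n → Bool
orderedEdge G i j = (toℕ i <ᵇ toℕ j) ∧ adj G i j

+size≡∑orderedEdge : ∀ {n} (G : Graph n) → + size G ≡ ∑[ i < n ] ∑[ j < n ] χ (orderedEdge G i j)
+size≡∑orderedEdge {n} G =
  trans (+-sum-allFin (λ i → ListSum.sum (map (λ j → if orderedEdge G i j then 1 else 0) (allFin n))))
        (sum-cong-≗ (λ i → trans (+-sum-allFin (λ j → if orderedEdge G i j then 1 else 0))
                                 (sum-cong-≗ (λ j → +-if (orderedEdge G i j)))))

χ-adj≡orderedEdge+orderedEdge : ∀ {n} (G : Graph n) i j → χ (adj G i j) ≡ χ (orderedEdge G i j) + χ (orderedEdge G j i)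
χ-adj≡orderedEdge+orderedEdge G i j
  with toℕ i <ᵇ toℕ j | <ᵇ-reflects-< (toℕ i) (toℕ j) | toℕ j <ᵇ toℕ i | <ᵇ-reflects-< (toℕ j) (toℕ i)
... | true  | ofʸ i<j | true  | ofʸ j<i = ⊥-elim (ℕP.<-asym i<j j<i)
... | true  | _       | false | _       = sym (ℤP.+-identityʳ _)
... | false | _       | true  | _       = trans (cong χ (Graph.sym G i j)) (sym (ℤP.+-identityˡ _))
... | false | ofⁿ i≮j | false | ofⁿ j≮i
  rewrite toℕ-injective (ℕP.≤-antisym (ℕP.≮⇒≥ j≮i) (ℕP.≮⇒≥ i≮j)) | Graph.irrefl G j = refl

handshake : ∀ {n} (G : Graph n) → ∑[ u < n ] openNbhdSum G (λ _ → 1ℤ) u ≡ + 2 * + size G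
handshake {n} G = begin
  ∑[ u < n ] ∑[ v < n ] (χ (adj G v u) * 1ℤ)
    ≡⟨ sum-cong-≗ (λ u → sum-cong-≗ (λ v → trans (ℤP.*-identityʳ _) (χ-adj≡orderedEdge+orderedEdge G v u))) ⟩
  ∑[ u < n ] ∑[ v < n ] (χ (orderedEdge G v u) + χ (orderedEdge G u v))
    ≡⟨ sum-cong-≗ (λ u → ∑-distrib-+ (λ v → χ (orderedEdge G v u)) (λ v → χ (orderedEdge G u v))) ⟩
  ∑[ u < n ] (∑[ v < n ] χ (orderedEdge G v u) + ∑[ v < n ] χ (orderedEdge G u v))
    ≡⟨ ∑-distrib-+ (λ u → ∑[ v < n ] χ (orderedEdge G v u)) (λ u → ∑[ v < n ] χ (orderedEdge G u v)) ⟩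
  ∑[ u < n ] ∑[ v < n ] χ (orderedEdge G v u) + ∑[ u < n ] ∑[ v < n ] χ (orderedEdge G u v)
    ≡⟨ cong (_+ ∑[ u < n ] ∑[ v < n ] χ (orderedEdge G u v)) (∑-comm (λ u v → χ (orderedEdge G v u))) ⟩
  ∑[ v < n ] ∑[ u < n ] χ (orderedEdge G v u) + ∑[ u < n ] ∑[ v < n ] χ (orderedEdge G u v)
    ≡⟨ cong₂ _+_ (+size≡∑orderedEdge G) (+size≡∑orderedEdge G) ⟨
  + size G + + size G
    ≡⟨ double (+ size G) ⟩
  + 2 * + size G ∎
  where
  open ≡-Reasoning
  double : ∀ s → s + s ≡ + 2 * s
  double = solve-∀

χ-adj+χ-adj-complement : ∀ {n} (G : Graph n) v u →
  χ (adj G v u) * 1ℤ + χ (adj (complement G) v u) * 1ℤ ≡ 1ℤ - χ ⌊ v ≟ u ⌋ * 1ℤ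
χ-adj+χ-adj-complement G v u with v ≟ u
... | yes refl rewrite Graph.irrefl G v = refl
... | no _     with adj G v u
...   | true  = refl
...   | false = refl

handshake-complement : ∀ {n} (G : Graph n) → + 2 * (+ size G + + size (complement G)) ≡ + n * (+ n - 1ℤ)
handshake-complement {n} G = begin
  + 2 * (+ size G + + size (complement G))
    ≡⟨ ℤP.*-distribˡ-+ (+ 2) (+ size G) (+ size (complement G)) ⟩
  + 2 * + size G + + 2 * + size (complement G)
    ≡⟨ cong₂ _+_ (handshake G) (handshake (complement G)) ⟨
  ∑[ u < n ] openNbhdSum G (λ _ → 1ℤ) u + ∑[ u < n ] openNbhdSum (complement G) (λ _ → 1ℤ) u
    ≡⟨ ∑-distrib-+ (openNbhdSum G (λ _ → 1ℤ)) (openNbhdSum (complement G) (λ _ → 1ℤ)) ⟨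
  ∑[ u < n ] (openNbhdSum G (λ _ → 1ℤ) u + openNbhdSum (complement G) (λ _ → 1ℤ) u)
    ≡⟨ sum-cong-≗ (λ u → trans (sym (∑-distrib-+ (λ v → χ (adj G v u) * 1ℤ)
                                                 (λ v → χ (adj (complement G) v u) * 1ℤ)))
                               (sum-cong-≗ (λ v → χ-adj+χ-adj-complement G v u))) ⟩
  ∑[ u < n ] ∑[ v < n ] (1ℤ - χ ⌊ v ≟ u ⌋ * 1ℤ)
    ≡⟨ sum-cong-≗ (λ u → trans (∑-distrib-- {n} (λ _ → 1ℤ) (λ v → χ ⌊ v ≟ u ⌋ * 1ℤ))
                               (cong₂ _-_ (sum-one n) (∑-select u (λ _ → 1ℤ)))) ⟩
  ∑[ u < n ] (+ n - 1ℤ)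
    ≡⟨ sum-const n (+ n - 1ℤ) ⟩
  + n * (+ n - 1ℤ) ∎
  where open ≡-Reasoning

+2*[nC2] : ∀ n → + 2 * + (n C 2) ≡ + n * (+ n - 1ℤ)
+2*[nC2] zero    = refl
+2*[nC2] (suc n) = begin
  + 2 * + (suc n C 2)
    ≡⟨ cong (λ c → + 2 * + c) (sym (nCk+nC[k+1]≡[n+1]C[k+1] n 1)) ⟩
  + 2 * + (n C 1 ℕ.+ n C 2)
    ≡⟨ cong (λ c → + 2 * c) (trans (ℤP.pos-+ (n C 1) (n C 2)) (cong (λ c → + c + + (n C 2)) (nC1≡n n))) ⟩
  + 2 * (+ n + + (n C 2))
    ≡⟨ ℤP.*-distribˡ-+ (+ 2) (+ n) (+ (n C 2)) ⟩
  + 2 * + n + + 2 * + (n C 2)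
    ≡⟨ cong (λ c → + 2 * + n + c) (+2*[nC2] n) ⟩
  + 2 * + n + + n * (+ n - 1ℤ)
    ≡⟨ pascal (+ n) ⟩
  (1ℤ + + n) * (1ℤ + + n - 1ℤ) ∎
  where
  open ≡-Reasoning
  pascal : ∀ a → + 2 * a + a * (a - 1ℤ) ≡ (1ℤ + a) * (1ℤ + a - 1ℤ)
  pascal = solve-∀

size-complement : ∀ {n} (G : Graph n) → size G ℕ.+ size (complement G) ≡ n C 2
size-complement {n} G = ℤP.+-injective (ℤP.*-cancelˡ-≡ (+ 2) _ _ (begin
  + 2 * + (size G ℕ.+ size (complement G))   ≡⟨ cong (+ 2 *_) (ℤP.pos-+ (size G) (size (complement G))) ⟩
  + 2 * (+ size G + + size (complement G))   ≡⟨ handshake-complement G ⟩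
  + n * (+ n - 1ℤ)                           ≡⟨ +2*[nC2] n ⟨
  + 2 * + (n C 2)                            ∎))
  where open ≡-Reasoning

-- Isomorphic graphs

complement-involutive : ∀ {n} (G : Graph n) → Isomorphic G (complement (complement G))
complement-involutive G = ↔-refl , λ i j → involutive i j
  where
  involutive : ∀ i j → adj (complement (complement G)) i j ≡ adj G i j
  involutive i j with i ≟ j
  ... | yes refl = sym (Graph.irrefl G i)
  ... | no _     with adj G i j
  ...   | true  = refl
  ...   | false = refl

module _ {n m : ℕ} {G : Graph n} {G′ : Graph m} (iso : Isomorphic G G′) where

  private
    σ = proj₁ iso
    open Inverse σ using (to; from; strictlyInverseˡ; strictlyInverseʳ)
    σ-adj : ∀ i j → adj G′ (to i) (to j) ≡ adj G i j
    σ-adj = proj₂ iso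

    ⌊to≟to⌋ : ∀ i j → ⌊ to i ≟ to j ⌋ ≡ ⌊ i ≟ j ⌋
    ⌊to≟to⌋ i j with to i ≟ to j | i ≟ j
    ... | yes _       | yes _    = refl
    ... | no _        | no _     = refl
    ... | yes toi≡toj | no i≢j   =
      ⊥-elim (i≢j (trans (sym (strictlyInverseʳ i)) (trans (cong from toi≡toj) (strictlyInverseʳ j))))
    ... | no toi≢toj  | yes refl = ⊥-elim (toi≢toj refl)

  Isomorphic-sym : Isomorphic G′ G
  Isomorphic-sym = ↔-sym σ , λ i j →
    trans (sym (σ-adj (from i) (from j))) (cong₂ (adj G′) (strictlyInverseˡ i) (strictlyInverseˡ j))

  Isomorphic-complement : Isomorphic (complement G) (complement G′)
  Isomorphic-complement = σ , λ i j → cong₂ (λ a b → not a ∧ not b) (⌊to≟to⌋ i j) (σ-adj i j)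

  openNbhdSum-iso : ∀ x u → openNbhdSum G′ x (to u) ≡ openNbhdSum G (λ v → x (to v)) u
  openNbhdSum-iso x u =
    trans (∑-permute (λ v → χ (adj G′ v (to u)) * x v) σ)
          (sum-cong-≗ (λ v → cong (λ b → χ b * x (to v)) (σ-adj v u)))

  Isomorphic⇒size≡ : size G ≡ size G′
  Isomorphic⇒size≡ = ℤP.+-injective (ℤP.*-cancelˡ-≡ (+ 2) (+ size G) (+ size G′) (begin
    + 2 * + size G                                  ≡⟨ handshake G ⟨
    ∑[ u < n ] openNbhdSum G (λ _ → 1ℤ) u           ≡⟨ sum-cong-≗ (openNbhdSum-iso (λ _ → 1ℤ)) ⟨
    ∑[ u < n ] openNbhdSum G′ (λ _ → 1ℤ) (to u)     ≡⟨ ∑-permute (openNbhdSum G′ (λ _ → 1ℤ)) σ ⟨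
    ∑[ u′ < m ] openNbhdSum G′ (λ _ → 1ℤ) u′        ≡⟨ handshake G′ ⟩
    + 2 * + size G′                                 ∎))
    where open ≡-Reasoning

  inClosedNbhd-iso : ∀ v u → inClosedNbhd G′ v (to u) ≡ inClosedNbhd G (from v) u
  inClosedNbhd-iso v u =
    trans (cong (λ w → ⌊ to u ≟ w ⌋ ∨ adj G′ w (to u)) (sym (strictlyInverseˡ v)))
          (cong₂ _∨_ (⌊to≟to⌋ u (from v)) (σ-adj (from v) u))

  module _ {ℓ : ℕ} .{{_ : NonZero ℓ}} where

    play-iso : ∀ ms (b : Labeling n ℓ) (b′ : Labeling m ℓ) → (∀ u → b′ (to u) ≡ b u) →
               ∀ u → play G′ ms b′ (to u) ≡ play G (map from ms) b u
    play-iso []       b b′ b′∘to≡b u = b′∘to≡b u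
    play-iso (v ∷ ms) b b′ b′∘to≡b u = play-iso ms (toggle G (from v) b) (toggle G′ v b′) toggled u
      where
      toggled : ∀ u → toggle G′ v b′ (to u) ≡ toggle G (from v) b u
      toggled u rewrite inClosedNbhd-iso v u | b′∘to≡b u = refl

    Isomorphic⇒NAW : IsNAW ℓ G′ → IsNAW ℓ G
    Isomorphic⇒NAW naw′ b = map from moves , λ u →
      trans (cong toℕ (sym (play-iso moves b (λ u′ → b (from u′)) (λ u → cong b (strictlyInverseʳ u)) u)))
            (proj₂ (naw′ (λ u′ → b (from u′))) (to u))
      where
      moves : List (Fin m)
      moves = proj₁ (naw′ (λ u′ → b (from u′)))

Isomorphic⇒NAW⇔ : ∀ {n m ℓ} .{{_ : NonZero ℓ}} {G : Graph n} {G′ : Graph m} →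
  Isomorphic G G′ → IsNAW ℓ G ⇔ IsNAW ℓ G′
Isomorphic⇒NAW⇔ {G = G} {G′} iso =
  mk⇔ (Isomorphic⇒NAW (Isomorphic-sym {G = G} {G′} iso)) (Isomorphic⇒NAW iso)

-- The complement of a corona

module Corona {h : ℕ} (H : Graph h)
  (corona-sym : ∀ x y → coronaAdj H x y ≡ coronaAdj H y x)
  (corona-irrefl : ∀ x → coronaAdj H x x ≡ false) where

  H⊙K₁ : Graph (h ℕ.+ h)
  H⊙K₁ = record { adj = coronaAdj H ; sym = corona-sym ; irrefl = corona-irrefl }

  inner leaf : Fin h → Fin (h ℕ.+ h)
  inner i = i ↑ˡ h
  leaf  i = h ↑ʳ i

  adj-inner-inner : ∀ i j → adj H⊙K₁ (inner i) (inner j) ≡ adj H i j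
  adj-inner-inner i j rewrite splitAt-↑ˡ h i h | splitAt-↑ˡ h j h = refl

  adj-inner-leaf : ∀ i j → adj H⊙K₁ (inner i) (leaf j) ≡ ⌊ i ≟ j ⌋
  adj-inner-leaf i j rewrite splitAt-↑ˡ h i h | splitAt-↑ʳ h h j = refl

  adj-leaf-inner : ∀ i j → adj H⊙K₁ (leaf i) (inner j) ≡ ⌊ i ≟ j ⌋
  adj-leaf-inner i j rewrite splitAt-↑ʳ h h i | splitAt-↑ˡ h j h = refl

  adj-leaf-leaf : ∀ i j → adj H⊙K₁ (leaf i) (leaf j) ≡ false
  adj-leaf-leaf i j rewrite splitAt-↑ʳ h h i | splitAt-↑ʳ h h j = refl

  openNbhdSum-inner : ∀ x i → openNbhdSum H⊙K₁ x (inner i) ≡ openNbhdSum H (λ j → x (inner j)) i + x (leaf i)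
  openNbhdSum-inner x i = trans (∑-↑ˡ-↑ʳ h h _) (cong₂ _+_
    (sum-cong-≗ (λ j → cong (λ b → χ b * x (inner j)) (adj-inner-inner j i)))
    (trans (sum-cong-≗ (λ j → cong (λ b → χ b * x (leaf j)) (adj-leaf-inner j i)))
           (∑-select i (λ j → x (leaf j)))))

  openNbhdSum-leaf : ∀ x i → openNbhdSum H⊙K₁ x (leaf i) ≡ x (inner i)
  openNbhdSum-leaf x i = begin
    openNbhdSum H⊙K₁ x (leaf i)
      ≡⟨ ∑-↑ˡ-↑ʳ h h _ ⟩
    ∑[ j < h ] (χ (adj H⊙K₁ (inner j) (leaf i)) * x (inner j))
      + ∑[ j < h ] (χ (adj H⊙K₁ (leaf j) (leaf i)) * x (leaf j))
      ≡⟨ cong₂ _+_ (sum-cong-≗ (λ j → cong (λ b → χ b * x (inner j)) (adj-inner-leaf j i)))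
                   (sum-zero (λ j → cong (λ b → χ b * x (leaf j)) (adj-leaf-leaf j i))) ⟩
    ∑[ j < h ] (χ ⌊ j ≟ i ⌋ * x (inner j)) + 0ℤ
      ≡⟨ trans (ℤP.+-identityʳ _) (∑-select i (λ j → x (inner j))) ⟩
    x (inner i) ∎
    where open ≡-Reasoning

  -- A = [[A_H , I] , [I , 0]] in the order (inner , leaf), and A⁻¹ = [[0 , I] , [I , -A_H]].
  adjInverse : (Fin (h ℕ.+ h) → ℤ) → Fin (h ℕ.+ h) → ℤ
  adjInverse t = (λ i → t (leaf i)) V.++ (λ i → t (inner i) - openNbhdSum H (λ j → t (leaf j)) i)

  adjInverse-inner : ∀ t i → adjInverse t (inner i) ≡ t (leaf i)
  adjInverse-inner t i =
    lookup-++ˡ (λ j → t (leaf j)) (λ j → t (inner j) - openNbhdSum H (λ k → t (leaf k)) j) i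

  adjInverse-leaf : ∀ t i → adjInverse t (leaf i) ≡ t (inner i) - openNbhdSum H (λ j → t (leaf j)) i
  adjInverse-leaf t i =
    lookup-++ʳ (λ j → t (leaf j)) (λ j → t (inner j) - openNbhdSum H (λ k → t (leaf k)) j) i

  openNbhdSum-adjInverse : ∀ t u → openNbhdSum H⊙K₁ (adjInverse t) u ≡ t u
  openNbhdSum-adjInverse t = ↑ˡ-↑ʳ-elim (λ u → openNbhdSum H⊙K₁ (adjInverse t) u ≡ t u) at-inner at-leaf
    where
    open ≡-Reasoning
    T : Fin h → ℤ
    T i = openNbhdSum H (λ j → t (leaf j)) i
    at-inner : ∀ i → openNbhdSum H⊙K₁ (adjInverse t) (inner i) ≡ t (inner i)
    at-inner i = begin
      openNbhdSum H⊙K₁ (adjInverse t) (inner i)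
        ≡⟨ openNbhdSum-inner (adjInverse t) i ⟩
      openNbhdSum H (λ j → adjInverse t (inner j)) i + adjInverse t (leaf i)
        ≡⟨ cong₂ _+_ (sum-cong-≗ (λ j → cong (χ (adj H j i) *_) (adjInverse-inner t j))) (adjInverse-leaf t i) ⟩
      T i + (t (inner i) - T i)
        ≡⟨ cancel (T i) (t (inner i)) ⟩
      t (inner i) ∎
      where
      cancel : ∀ a b → a + (b - a) ≡ b
      cancel = solve-∀
    at-leaf : ∀ i → openNbhdSum H⊙K₁ (adjInverse t) (leaf i) ≡ t (leaf i)
    at-leaf i = trans (openNbhdSum-leaf (adjInverse t) i) (adjInverse-inner t i)

  y : Fin (h ℕ.+ h) → ℤ
  y = adjInverse (λ _ → 1ℤ)

  sum-adjInverse : ∀ t → sum (adjInverse t) ≡ ∑[ u < h ℕ.+ h ] (y u * t u)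
  sum-adjInverse t = sym (begin
    ∑[ u < h ℕ.+ h ] (y u * t u)
      ≡⟨ sum-cong-≗ (λ u → cong (y u *_) (openNbhdSum-adjInverse t u)) ⟨
    ∑[ u < h ℕ.+ h ] (y u * openNbhdSum H⊙K₁ (adjInverse t) u)
      ≡⟨ openNbhdSum-adjoint H⊙K₁ y (adjInverse t) ⟩
    ∑[ v < h ℕ.+ h ] (openNbhdSum H⊙K₁ y v * adjInverse t v)
      ≡⟨ sum-cong-≗ (λ v → trans (cong (_* adjInverse t v) (openNbhdSum-adjInverse (λ _ → 1ℤ) v))
                                 (ℤP.*-identityˡ _)) ⟩
    sum (adjInverse t) ∎)
    where open ≡-Reasoning

  private
    degreeSum : ℤ
    degreeSum = ∑[ i < h ] openNbhdSum H (λ _ → 1ℤ) i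

    sum-y : sum y ≡ + h + (+ h - degreeSum)
    sum-y = trans (∑-↑ˡ-↑ʳ h h y) (cong₂ _+_
      (trans (sum-cong-≗ (adjInverse-inner (λ _ → 1ℤ))) (sum-one h))
      (trans (sum-cong-≗ (adjInverse-leaf (λ _ → 1ℤ)))
             (trans (∑-distrib-- (λ _ → 1ℤ) (openNbhdSum H (λ _ → 1ℤ))) (cong (_- degreeSum) (sum-one h)))))

    handshake-corona : + 2 * + size H⊙K₁ ≡ degreeSum + + h + + h
    handshake-corona = begin
      + 2 * + size H⊙K₁
        ≡⟨ handshake H⊙K₁ ⟨
      ∑[ u < h ℕ.+ h ] openNbhdSum H⊙K₁ (λ _ → 1ℤ) u
        ≡⟨ ∑-↑ˡ-↑ʳ h h _ ⟩
      ∑[ i < h ] openNbhdSum H⊙K₁ (λ _ → 1ℤ) (inner i) + ∑[ i < h ] openNbhdSum H⊙K₁ (λ _ → 1ℤ) (leaf i)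
        ≡⟨ cong₂ _+_ (trans (sum-cong-≗ (openNbhdSum-inner (λ _ → 1ℤ)))
                            (trans (∑-distrib-+ (openNbhdSum H (λ _ → 1ℤ)) (λ _ → 1ℤ))
                                   (cong (λ s → degreeSum + s) (sum-one h))))
                     (trans (sum-cong-≗ (openNbhdSum-leaf (λ _ → 1ℤ))) (sum-one h)) ⟩
      degreeSum + + h + + h ∎
      where open ≡-Reasoning

  sum-y≡2[order-size] : + 2 * (+ (h ℕ.+ h) - + size H⊙K₁) ≡ sum y
  sum-y≡2[order-size] = begin
    + 2 * (+ (h ℕ.+ h) - + size H⊙K₁)          ≡⟨ cong (λ n → + 2 * (n - + size H⊙K₁)) (ℤP.pos-+ h h) ⟩
    + 2 * (+ h + + h - + size H⊙K₁)            ≡⟨ expand (+ h) (+ size H⊙K₁) ⟩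
    + 2 * (+ h + + h) - + 2 * + size H⊙K₁      ≡⟨ cong (λ s → + 2 * (+ h + + h) - s) handshake-corona ⟩
    + 2 * (+ h + + h) - (degreeSum + + h + + h) ≡⟨ simplify (+ h) degreeSum ⟩
    + h + (+ h - degreeSum)                 ≡⟨ sum-y ⟨
    sum y ∎
    where
    open ≡-Reasoning
    expand : ∀ a s → + 2 * (a + a - s) ≡ + 2 * (a + a) - + 2 * s
    expand = solve-∀
    simplify : ∀ a D → + 2 * (a + a) - (D + a + a) ≡ a + (a - D)
    simplify = solve-∀

  module _ {ℓ : ℕ} .{{_ : NonZero ℓ}} where

    complement-reachable : ∀ a → a * (sum y - 1ℤ) ≡ 1ℤ mod + ℓ →
      ∀ t → ∃[ x ] ∀ u → closedNbhdSum (complement H⊙K₁) x u ≡ t u mod + ℓ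
    complement-reachable a a-inverse t = x , reaches
      where
      yt c : ℤ
      yt = ∑[ u < h ℕ.+ h ] (y u * t u)
      c  = a * yt
      x : Fin (h ℕ.+ h) → ℤ
      x v = c * y v - adjInverse t v
      reaches : ∀ u → closedNbhdSum (complement H⊙K₁) x u ≡ t u mod + ℓ
      reaches u = begin
        closedNbhdSum (complement H⊙K₁) x u
          ≡⟨ closedNbhdSum-complement H⊙K₁ x u ⟩
        sum x - openNbhdSum H⊙K₁ x u
          ≡⟨ cong₂ _-_ (trans (∑-scale-sub c y (adjInverse t)) (cong (λ s → c * sum y - s) (sum-adjInverse t)))
                       (trans (openNbhdSum-scale-sub H⊙K₁ c y (adjInverse t) u)
                              (cong₂ (λ p q → c * p - q) (openNbhdSum-adjInverse (λ _ → 1ℤ) u)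
                                                         (openNbhdSum-adjInverse t u))) ⟩
        (c * sum y - yt) - (c * 1ℤ - t u)
          ≡⟨ regroup a yt (sum y) (t u) ⟩
        t u + yt * (a * (sum y - 1ℤ)) - yt
          ≈⟨ ≡-mod-+ (≡-mod-+ˡ (t u) (≡-mod-*ˡ yt a-inverse)) ≡-mod-refl ⟩
        t u + yt * 1ℤ - yt
          ≡⟨ cancel (t u) yt ⟩
        t u ∎
        where
        open ≡-mod-Reasoning {q = + ℓ}
        regroup : ∀ a Y S T → (a * Y * S - Y) - (a * Y * 1ℤ - T) ≡ T + Y * (a * (S - 1ℤ)) - Y
        regroup = solve-∀
        cancel : ∀ T Y → T + Y * 1ℤ - Y ≡ T
        cancel = solve-∀

    complement-NAW⇒coprime : 2 ≤ ℓ → IsNAW ℓ (complement H⊙K₁) → gcd (sum y - 1ℤ) (+ ℓ) ≡ + 1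
    complement-NAW⇒coprime 2≤ℓ naw =
      cong +_ (∣1⇒≡1 (∣⇒∣ᵤ (subst (g ∣_) (ℤP.+-identityʳ 1ℤ) (divides-difference one≡0))))
      where
      d g : ℤ
      d = sum y - 1ℤ
      g = gcd d (+ ℓ)
      d≡0 : d ≡ 0ℤ mod g
      d≡0 = ∣⇒≡0-mod (∣ᵤ⇒∣ (gcd[i,j]∣i d (+ ℓ)))
      balanced : ∀ v → closedNbhdSum (complement H⊙K₁) y v ≡ 0ℤ mod g
      balanced v = ≡-mod-trans (≡-mod-reflexive (trans (closedNbhdSum-complement H⊙K₁ y v)
                                  (cong (λ s → sum y - s) (openNbhdSum-adjInverse (λ _ → 1ℤ) v)))) d≡0
      sum-y≡0 : sum y ≡ 0ℤ mod g
      sum-y≡0 = ∑≡0-mod (λ u → ∣⇒≡0-mod (NAW⇒balanced-weight-divisible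
                  (complement H⊙K₁) (∣ᵤ⇒∣ (gcd[i,j]∣j d (+ ℓ))) y balanced 2≤ℓ naw u))
      one≡0 : 1ℤ ≡ 0ℤ mod g
      one≡0 = begin
        1ℤ          ≡⟨ unwind (sum y) ⟩
        sum y - d   ≈⟨ ≡-mod-+ sum-y≡0 (≡-mod-neg d≡0) ⟩
        0ℤ - 0ℤ     ≡⟨⟩
        0ℤ ∎
        where
        open ≡-mod-Reasoning {q = g}
        unwind : ∀ s → 1ℤ ≡ s - (s - 1ℤ)
        unwind = solve-∀

    complement-NAW⇔coprime : 2 ≤ ℓ → IsNAW ℓ (complement H⊙K₁) ⇔ gcd (sum y - 1ℤ) (+ ℓ) ≡ + 1
    complement-NAW⇔coprime 2≤ℓ = mk⇔ (complement-NAW⇒coprime 2≤ℓ) coprime⇒NAW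
      where
      coprime⇒NAW : gcd (sum y - 1ℤ) (+ ℓ) ≡ + 1 → IsNAW ℓ (complement H⊙K₁)
      coprime⇒NAW coprime with a , a-inverse ← gcd≡1⇒invertible (sum y - 1ℤ) ℓ coprime =
        reachable⇒NAW (complement H⊙K₁) (complement-reachable a a-inverse)

pendant-complement-NAW⇔ : ∀ ℓ .{{_ : NonZero ℓ}} → 2 ≤ ℓ → ∀ n (G : Graph n) → IsPendant G →
  IsNAW ℓ (complement G) ⇔ gcd (+ 2 * (+ n - + size G) - + 1) (+ ℓ) ≡ + 1
pendant-complement-NAW⇔ ℓ 2≤ℓ n G (h , H , corona-sym , corona-irrefl , iso) =
  subst (λ e → IsNAW ℓ (complement G) ⇔ gcd e (+ ℓ) ≡ + 1) (sym d≡)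
        (⇔-trans (Isomorphic⇒NAW⇔ (Isomorphic-complement {G = G} {H⊙K₁} iso)) (complement-NAW⇔coprime 2≤ℓ))
  where
  open Corona H corona-sym corona-irrefl
  d≡ : + 2 * (+ n - + size G) - + 1 ≡ sum y - 1ℤ
  d≡ = begin
    + 2 * (+ n - + size G) - + 1
      ≡⟨ cong₂ (λ o s → + 2 * (+ o - + s) - + 1) (↔⇒≡ (proj₁ iso)) (Isomorphic⇒size≡ {G = G} {H⊙K₁} iso) ⟩
    + 2 * (+ (h ℕ.+ h) - + size H⊙K₁) - + 1
      ≡⟨ cong (_- 1ℤ) sum-y≡2[order-size] ⟩
    sum y - 1ℤ ∎
    where open ≡-Reasoning

2[n-size-complement]-1≡n-2k-1 : ∀ {n k} (G : Graph n) → n % 2 ≡ 0 → size G ℕ.+ (n / 2 ℕ.+ k) ≡ n C 2 →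
  + 2 * (+ n - + size (complement G)) - + 1 ≡ + n - + 2 * + k - + 1
2[n-size-complement]-1≡n-2k-1 {n} {k} G n-even size≡ = begin
  + 2 * (+ n - + size (complement G)) - + 1           ≡⟨ cong (λ s → + 2 * (+ n - s) - + 1) +size-complement ⟩
  + 2 * (+ n - (+ (n / 2) + + k)) - + 1              ≡⟨ cong (λ m → + 2 * (m - (+ (n / 2) + + k)) - + 1) n≡2*half ⟩
  + 2 * (+ 2 * + (n / 2) - (+ (n / 2) + + k)) - + 1  ≡⟨ halve (+ (n / 2)) (+ k) ⟩
  + 2 * + (n / 2) - + 2 * + k - + 1                  ≡⟨ cong (λ m → m - + 2 * + k - + 1) n≡2*half ⟨
  + n - + 2 * + k - + 1                              ∎
  where
  open ≡-Reasoning
  +size-complement : + size (complement G) ≡ + (n / 2) + + k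
  +size-complement = trans (cong +_ (ℕP.+-cancelˡ-≡ (size G) _ _ (trans (size-complement G) (sym size≡))))
                           (ℤP.pos-+ (n / 2) k)
  n≡2*half : + n ≡ + 2 * + (n / 2)
  n≡2*half = trans (cong +_ (trans (m≡m%n+[m/n]*n n 2)
                                   (trans (cong (ℕ._+ n / 2 ℕ.* 2) n-even) (ℕP.*-comm (n / 2) 2))))
                   (ℤP.pos-* 2 (n / 2))
  halve : ∀ m k → + 2 * (+ 2 * m - (m + k)) - + 1 ≡ + 2 * m - + 2 * k - + 1
  halve = solve-∀

complement-pendant-NAW⇔ : ∀ ℓ .{{_ : NonZero ℓ}} → 2 ≤ ℓ → ∀ n k (G : Graph n) →
  n % 2 ≡ 0 → size G ℕ.+ (n / 2 ℕ.+ k) ≡ n C 2 → IsPendant (complement G) →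
  IsNAW ℓ G ⇔ gcd (+ n - + 2 * + k - + 1) (+ ℓ) ≡ + 1
complement-pendant-NAW⇔ ℓ 2≤ℓ n k G n-even size≡ pendant =
  subst (λ e → IsNAW ℓ G ⇔ gcd e (+ ℓ) ≡ + 1) (2[n-size-complement]-1≡n-2k-1 G n-even size≡)
        (⇔-trans (Isomorphic⇒NAW⇔ (complement-involutive G))
                 (pendant-complement-NAW⇔ ℓ 2≤ℓ n (complement G) pendant))

lemma3p10 : (ℓ : ℕ) .{{_ : NonZero ℓ}} → 2 ≤ ℓ →
    ((n : ℕ) (G : Graph n) → IsPendant G →
      (IsNAW ℓ (complement G) ⇔
        (gcd (+ 2 * (+ n - + size G) - + 1) (+ ℓ) ≡ + 1)))
    ×
    ((n k : ℕ) (G : Graph n) → n % 2 ≡ 0 →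
      size G Data.Nat.+ (n / 2 Data.Nat.+ k) ≡ n C 2 →
      IsPendant (complement G) →
      (IsNAW ℓ G ⇔ (gcd (+ n - + 2 * + k - + 1) (+ ℓ) ≡ + 1)))
lemma3p10 ℓ 2≤ℓ = pendant-complement-NAW⇔ ℓ 2≤ℓ , complement-pendant-NAW⇔ ℓ 2≤ℓ
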